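{- Let $n\ge k\ge 2$ be integers. If $\mathcal{F}\subseteq\mathbb{Z}_{2^n}$ does not contain a projective $2^{k-1}$-cube, then $|\mathcal{F}|\le |L_1\cup L_2\cup\dots\cup L_{k-1}|$ (which equals $2^n-2^{n-k+1}$).
   Context: $\mathbb{Z}_{2^n}$ is the cyclic group of integers modulo $2^n$. For $1\le i\le n$ the $i$-th layer is $L_i=\{x\in\mathbb{Z}_{2^n}: x\equiv 2^{i-1} \pmod{2^i}\}$, and $L_{n+1}=\{0\}$; thus $|L_i|=2^{n-i}$ for $i\le n$. For a multiset $S=\{a_1,\dots,a_d\}$ of $d$ not necessarily distinct elements of $\mathbb{Z}_{2^n}$, the projective $d$-cube generated by $S$ is the set $\Sigma^*S=\{\sum_{i\in I}a_i \bmod 2^n : \emptyset\neq I\subseteq\{1,\dots,d\}\}$ (viewed as a set). A set $A\subseteq\mathbb{Z}_{2^n}$ contains a projective $d$-cube if there is a multiset $S$ of size $d$ with $\Sigma^*S\subseteq A$. -}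

module Defs where

import Data.Nat
open import Data.Nat using (ℕ; zero; suc; _+_; _^_; _%_; _≡ᵇ_; _<_; _∸_)
open import Data.Bool using (Bool; true; false; _∨_; if_then_else_)
open import Data.List using (List; filter; upTo; length; any)
open import Data.List.Membership.Propositional using (_∈_)
open import Data.Vec using (Vec; []; _∷_)
open import Data.Fin.Subset using (Subset; Nonempty)
open import Relation.Nullary.Decidable using (does)
open import Data.Bool.Properties using (T?)
open import Data.Nat.Properties using (m^n≢0)

_mod2^_ : ℕ → ℕ → ℕ
x mod2^ i = _%_ x (2 ^ i) {{m^n≢0 2 i}}


-- Elements of ℤ_{2^n} are represented by naturals x < 2^n.

inLayerᵇ : ℕ → ℕ → Bool
inLayerᵇ i x = (x mod2^ i) ≡ᵇ (2 ^ (i ∸ 1))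

inLayersUpToᵇ : ℕ → ℕ → Bool
inLayersUpToᵇ zero    x = false
inLayersUpToᵇ (suc m) x = inLayersUpToᵇ m x ∨ inLayerᵇ (suc m) x

layersUpTo : (n m : ℕ) → List ℕ
layersUpTo n m = filter (λ x → T? (inLayersUpToᵇ m x)) (upTo (2 ^ n))

subsetSum : ∀ {d} → Vec ℕ d → Subset d → ℕ
subsetSum []       []          = 0
subsetSum (a ∷ as) (true ∷ I)  = a + subsetSum as I
subsetSum (a ∷ as) (false ∷ I) = subsetSum as I

ProjCubeIn : (n : ℕ) → ∀ {d} → Vec ℕ d → List ℕ → Set
ProjCubeIn n {d} S F = (I : Subset d) → Nonempty I → (subsetSum S I mod2^ n) ∈ F

-- F contains a projective d-cube: some multiset S of d elements of ℤ_{2^n}.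
ContainsProjCube : (n d : ℕ) → List ℕ → Set
ContainsProjCube n d F =
  Data.Product.Σ (Vec ℕ d) λ S → Data.Vec.Relation.Unary.All.All (λ a → a < 2 ^ n) S
    Data.Product.× ProjCubeIn n S F
  where import Data.Product; import Data.Vec.Relation.Unary.All

module Submission where

-- Let n ≥ k ≥ 2, e = k - 1, d = 2^e, and let G be the set of residues in
-- ℤ_{2^n} missing from F.  The complement of L_1 ∪ ... ∪ L_e is the set of
-- multiples of 2^e, so it has at most 2^(n-e) elements; hence it suffices to
-- show |G| ≥ 2^(n-e) whenever F contains no projective d-cube.  Two cases:
--   (A) some odd a has c·a ∈ F for all 1 ≤ c < d.  Then each block
--       {(m·d + c)·a : c < d}, m < 2^(n-e), meets G, since otherwise F would
--       contain the cube generated by m·d·a and d - 1 copies of a.  Odd a is a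
--       unit, so the blocks are disjoint and |G| ≥ 2^(n-e).
--   (B) every odd a has a multiple c·a ∈ G with 1 ≤ c < d.  Double counting
--       the pairs (a, c) (multiplication by an odd c permutes the residues of
--       each 2-adic valuation) gives 2^(n-1) ≤ 2^(e-1)·|G|.

open import Defs
open import Data.Nat
open import Data.Nat.Properties
open import Data.Nat.DivMod
open import Data.Nat.Divisibility
open import Data.Nat.Primality using (euclidsLemma; prime[2])
open import Data.Bool using (Bool; true; false; T; _∨_; _∧_; not; if_then_else_)
open import Data.Bool.Properties using (T?; ∧-identityʳ; ∧-zeroʳ; not-injective)
open import Data.Product using (_×_; _,_; proj₁; proj₂)
open import Data.Sum using (_⊎_; inj₁; inj₂)
open import Data.Empty using (⊥-elim)
open import Data.List using (List; []; _∷_; length; filter; upTo; _++_)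
import Data.List.Properties as List
open import Data.List.Relation.Unary.All using (All; []; _∷_)
open import Data.List.Relation.Unary.Unique.Propositional using (Unique; []; _∷_)
open import Data.List.Relation.Unary.All.Properties using (All¬⇒¬Any)
open import Data.List.Membership.Propositional using (_∈_)
open import Data.List.Membership.DecPropositional _≟_ using (_∈?_)
open import Data.List.Relation.Unary.Any using (here)
open import Data.Vec using ([]; _∷_; replicate; there)
import Data.Vec.Relation.Unary.All as Vec
open import Data.Fin using (suc)
open import Data.Fin.Subset using (Subset; Nonempty; ∣_∣)
open import Data.Fin.Subset.Properties using (∣p∣≤n)
open import Relation.Binary.PropositionalEquality
open import Relation.Nullary using (¬_; yes; no; does)
open import Relation.Nullary.Decidable using (dec-true; dec-false)
open import Algebra.Properties.CommutativeSemigroup +-commutativeSemigroup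
  using (interchange)
open import Data.Nat.Solver using (module +-*-Solver)
open +-*-Solver using (solve; _:+_; _:*_; _:=_; con)

ind : Bool → ℕ
ind true  = 1
ind false = 0

count : (ℕ → Bool) → ℕ → ℕ
count p zero    = 0
count p (suc K) = count p K + ind (p K)

count-cong : ∀ {p q} K → (∀ x → x < K → p x ≡ q x) → count p K ≡ count q K
count-cong zero    p≗q = refl
count-cong (suc K) p≗q =
  cong₂ _+_ (count-cong K (λ x x<K → p≗q x (m<n⇒m<1+n x<K))) (cong ind (p≗q K ≤-refl))

count-true : ∀ K → count (λ _ → true) K ≡ K
count-true zero    = refl
count-true (suc K) = trans (cong (_+ 1) (count-true K)) (+-comm K 1)

count-false : ∀ K → count (λ _ → false) K ≡ 0
count-false zero    = refl
count-false (suc K) = cong (_+ 0) (count-false K)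

count-∨ : ∀ p q K → count (λ x → p x ∨ q x) K ≤ count p K + count q K
count-∨ p q zero    = z≤n
count-∨ p q (suc K) = begin
  count (λ x → p x ∨ q x) K + ind (p K ∨ q K)
    ≤⟨ +-mono-≤ (count-∨ p q K) (ind-∨ (p K) (q K)) ⟩
  (count p K + count q K) + (ind (p K) + ind (q K))
    ≡⟨ interchange (count p K) (count q K) (ind (p K)) (ind (q K)) ⟩
  (count p K + ind (p K)) + (count q K + ind (q K)) ∎
  where
  open ≤-Reasoning
  ind-∨ : ∀ a b → ind (a ∨ b) ≤ ind a + ind b
  ind-∨ true  b = s≤s z≤n
  ind-∨ false b = ≤-refl

count-complement : ∀ p K → count p K + count (λ x → not (p x)) K ≡ K
count-complement p zero    = refl
count-complement p (suc K) = begin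
  (count p K + ind (p K)) + (count (λ x → not (p x)) K + ind (not (p K)))
    ≡⟨ interchange (count p K) (ind (p K)) _ _ ⟩
  (count p K + count (λ x → not (p x)) K) + (ind (p K) + ind (not (p K)))
    ≡⟨ cong₂ _+_ (count-complement p K) (ind-not (p K)) ⟩
  K + 1
    ≡⟨ +-comm K 1 ⟩
  suc K ∎
  where
  open ≡-Reasoning
  ind-not : ∀ a → ind a + ind (not a) ≡ 1
  ind-not true  = refl
  ind-not false = refl

count-+ : ∀ p K L → count p (K + L) ≡ count p K + count (λ x → p (K + x)) L
count-+ p K zero    rewrite +-identityʳ K = sym (+-identityʳ _)
count-+ p K (suc L) rewrite +-suc K L =
  trans (cong (_+ ind (p (K + L))) (count-+ p K L)) (+-assoc (count p K) _ _)

count-even-odd : ∀ p K →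
  count p (2 * K) ≡ count (λ x → p (2 * x)) K + count (λ x → p (suc (2 * x))) K
count-even-odd p zero    = refl
count-even-odd p (suc K) = begin
  count p (2 * suc K)
    ≡⟨ cong (count p) (*-suc 2 K) ⟩
  (count p (2 * K) + ind (p (2 * K))) + ind (p (suc (2 * K)))
    ≡⟨ +-assoc (count p (2 * K)) _ _ ⟩
  count p (2 * K) + (ind (p (2 * K)) + ind (p (suc (2 * K))))
    ≡⟨ cong (_+ (ind (p (2 * K)) + ind (p (suc (2 * K))))) (count-even-odd p K) ⟩
  (evens + odds) + (ind (p (2 * K)) + ind (p (suc (2 * K))))
    ≡⟨ interchange evens odds _ _ ⟩
  (evens + ind (p (2 * K))) + (odds + ind (p (suc (2 * K)))) ∎
  where
  open ≡-Reasoning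
  evens = count (λ x → p (2 * x)) K
  odds  = count (λ x → p (suc (2 * x))) K

delete : (ℕ → Bool) → ℕ → ℕ → Bool
delete q x y = q y ∧ not (does (y ≟ x))

delete-≢ : ∀ q {x y} → y ≢ x → delete q x y ≡ q y
delete-≢ q {x} {y} y≢x =
  trans (cong (λ b → q y ∧ not b) (dec-false (y ≟ x) y≢x)) (∧-identityʳ (q y))

delete-self : ∀ q x → delete q x x ≡ false
delete-self q x =
  trans (cong (λ b → q x ∧ not b) (dec-true (x ≟ x) refl)) (∧-zeroʳ (q x))

count-delete : ∀ q {x} K → x < K → q x ≡ true → count q K ≡ suc (count (delete q x) K)
count-delete q {x} (suc K) x<1+K qx with x ≟ K
... | yes refl = begin
  count q x + ind (q x)                           ≡⟨ cong (λ b → count q x + ind b) qx ⟩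
  count q x + 1                                   ≡⟨ +-comm (count q x) 1 ⟩
  suc (count q x)                                 ≡⟨ cong suc (count-cong x below) ⟩
  suc (count (delete q x) x)                      ≡⟨ cong suc (+-identityʳ _) ⟨
  suc (count (delete q x) x + 0)
    ≡⟨ cong (λ b → suc (count (delete q x) x + ind b)) (delete-self q x) ⟨
  suc (count (delete q x) x + ind (delete q x x)) ∎
  where
  open ≡-Reasoning
  below : ∀ y → y < x → q y ≡ delete q x y
  below y y<x = sym (delete-≢ q (<⇒≢ y<x))
... | no x≢K = cong₂ (λ c b → c + ind b)
                 (count-delete q K (≤∧≢⇒< (≤-pred x<1+K) x≢K) qx)
                 (sym (delete-≢ q (λ K≡x → x≢K (sym K≡x))))


count-injection : ∀ {P Q} (f : ℕ → ℕ) M K →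
  (∀ i → i < M → P i ≡ true → f i < K × Q (f i) ≡ true) →
  (∀ i j → i < M → j < M → P i ≡ true → P j ≡ true → f i ≡ f j → i ≡ j) →
  count P M ≤ count Q K
count-injection f zero K maps inj = z≤n
count-injection {P} {Q} f (suc M) K maps inj with P M in PM
... | false = ≤-trans (≤-reflexive (+-identityʳ _))
                (count-injection f M K (λ i i<M → maps i (m<n⇒m<1+n i<M))
                   (λ i j i<M j<M → inj i j (m<n⇒m<1+n i<M) (m<n⇒m<1+n j<M)))
... | true = begin
  count P M + 1                  ≡⟨ +-comm (count P M) 1 ⟩
  suc (count P M)                ≤⟨ s≤s (count-injection f M K maps′ inj′) ⟩
  suc (count (delete Q (f M)) K) ≡⟨ count-delete Q K (proj₁ fM) (proj₂ fM) ⟨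
  count Q K ∎
  where
  open ≤-Reasoning
  fM = maps M ≤-refl PM
  inj′ : ∀ i j → i < M → j < M → P i ≡ true → P j ≡ true → f i ≡ f j → i ≡ j
  inj′ i j i<M j<M = inj i j (m<n⇒m<1+n i<M) (m<n⇒m<1+n j<M)
  maps′ : ∀ i → i < M → P i ≡ true → f i < K × delete Q (f M) (f i) ≡ true
  maps′ i i<M Pi = proj₁ fi , trans (delete-≢ Q fi≢fM) (proj₂ fi)
    where
    fi = maps i (m<n⇒m<1+n i<M) Pi
    fi≢fM : f i ≢ f M
    fi≢fM fi≡fM = <⇒≢ i<M (inj i M (m<n⇒m<1+n i<M) ≤-refl Pi PM fi≡fM)

anyBelow : ℕ → (ℕ → Bool) → Bool
anyBelow zero    h = false
anyBelow (suc L) h = anyBelow L h ∨ h L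

anyBelow-false : ∀ L h → anyBelow L h ≡ false → ∀ j → j < L → h j ≡ false
anyBelow-false (suc L) h none j j<1+L with anyBelow L h in below | h L in top
anyBelow-false (suc L) h refl j j<1+L | false | false with m<1+n⇒m<n∨m≡n j<1+L
... | inj₁ j<L  = anyBelow-false L h below j j<L
... | inj₂ refl = top

witness : ℕ → (ℕ → Bool) → ℕ
witness zero    h = 0
witness (suc L) h = if anyBelow L h then witness L h else L

witness-spec : ∀ L h → anyBelow L h ≡ true → witness L h < L × h (witness L h) ≡ true
witness-spec (suc L) h some with anyBelow L h in below
... | true  = let (w<L , hw) = witness-spec L h below in m<n⇒m<1+n w<L , hw
... | false = ≤-refl , some

count-anyBelow : ∀ L K B (h : ℕ → ℕ → Bool) → (∀ j → j < L → count (h j) K ≤ B) →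
  count (λ x → anyBelow L (λ j → h j x)) K ≤ L * B
count-anyBelow zero    K B h bound = ≤-reflexive (count-false K)
count-anyBelow (suc L) K B h bound = begin
  count (λ x → anyBelow L (λ j → h j x) ∨ h L x) K
    ≤⟨ count-∨ (λ x → anyBelow L (λ j → h j x)) (h L) K ⟩
  count (λ x → anyBelow L (λ j → h j x)) K + count (h L) K
    ≤⟨ +-mono-≤ (count-anyBelow L K B h (λ j j<L → bound j (m<n⇒m<1+n j<L))) (bound L ≤-refl) ⟩
  L * B + B
    ≡⟨ +-comm (L * B) B ⟩
  suc L * B ∎
  where open ≤-Reasoning

even-or-odd : ∀ y → y ≡ 2 * (y / 2) ⊎ y ≡ suc (2 * (y / 2))
even-or-odd y with y % 2 | m%n<n y 2 | m≡m%n+[m/n]*n y 2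
... | 0           | _             | y≡ = inj₁ (trans y≡ (*-comm (y / 2) 2))
... | 1           | _             | y≡ = inj₂ (trans y≡ (cong suc (*-comm (y / 2) 2)))
... | suc (suc _) | s≤s (s≤s ()) | _

2∤odd : ∀ i → ¬ 2 ∣ suc (2 * i)
2∤odd i 2∣odd
  with () ← ∣1⇒≡1 (∣m+n∣m⇒∣n (subst (2 ∣_) (+-comm 1 (2 * i)) 2∣odd) (m∣m*n i))

2∤odd*odd : ∀ j i → ¬ 2 ∣ suc (2 * j) * suc (2 * i)
2∤odd*odd j i 2∣prod with euclidsLemma (suc (2 * j)) (suc (2 * i)) prime[2] 2∣prod
... | inj₁ 2∣l = 2∤odd j 2∣l
... | inj₂ 2∣r = 2∤odd i 2∣r

odd⇒≡suc[2*half] : ∀ y → ¬ 2 ∣ y → y ≡ suc (2 * (y / 2))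
odd⇒≡suc[2*half] y 2∤y with even-or-odd y
... | inj₁ y≡even = ⊥-elim (2∤y (divides (y / 2) (trans y≡even (*-comm 2 (y / 2)))))
... | inj₂ y≡odd  = y≡odd

half<2^ : ∀ e c → c < 2 ^ suc e → c / 2 < 2 ^ e
half<2^ e c c< = m<n*o⇒m/o<n (subst (c <_) (*-comm 2 (2 ^ e)) c<)

odd<2^ : ∀ n i → i < 2 ^ n → suc (2 * i) < 2 ^ suc n
odd<2^ n i i< = subst (_≤ 2 ^ suc n) (*-suc 2 i) (*-monoʳ-≤ 2 i<)

2^e*2^[n∸e] : ∀ e n → e ≤ n → 2 ^ e * 2 ^ (n ∸ e) ≡ 2 ^ n
2^e*2^[n∸e] e n e≤n = trans (sym (^-distribˡ-+-* 2 e (n ∸ e))) (cong (2 ^_) (m+[n∸m]≡n e≤n))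

mod2^< : ∀ x n → x mod2^ n < 2 ^ n
mod2^< x n = m%n<n x (2 ^ n) {{m^n≢0 2 n}}

mod2^-+ˡ : ∀ n x y → ((x mod2^ n) + y) mod2^ n ≡ (x + y) mod2^ n
mod2^-+ˡ n x y = begin
  (x % N + y) % N            ≡⟨ %-distribˡ-+ (x % N) y N ⟩
  (x % N % N + y % N) % N    ≡⟨ cong (λ u → (u + y % N) % N) (m%n%n≡m%n x N) ⟩
  (x % N + y % N) % N        ≡⟨ %-distribˡ-+ x y N ⟨
  (x + y) % N ∎
  where
  open ≡-Reasoning
  N = 2 ^ n
  instance _ = m^n≢0 2 n

mod2^-*ʳ : ∀ n c a → (c * (a mod2^ n)) mod2^ n ≡ (c * a) mod2^ n
mod2^-*ʳ n c a = begin
  (c * (a % N)) % N                ≡⟨ %-distribˡ-* c (a % N) N ⟩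
  ((c % N) * (a % N % N)) % N      ≡⟨ cong (λ u → ((c % N) * u) % N) (m%n%n≡m%n a N) ⟩
  ((c % N) * (a % N)) % N          ≡⟨ %-distribˡ-* c a N ⟨
  (c * a) % N ∎
  where
  open ≡-Reasoning
  N = 2 ^ n
  instance _ = m^n≢0 2 n

mod2^-double : ∀ n x → (2 * x) mod2^ suc n ≡ 2 * (x mod2^ n)
mod2^-double n x = begin
  _%_ (2 * x) (2 ^ suc n) {{m^n≢0 2 (suc n)}}
    ≡⟨ %-congʳ {o = 2 * x} {{m^n≢0 2 (suc n)}} {{nz}} (*-comm 2 (2 ^ n)) ⟩
  _%_ (2 * x) (2 ^ n * 2) {{nz}}
    ≡⟨ cong (λ u → _%_ u (2 ^ n * 2) {{nz}}) (*-comm 2 x) ⟩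
  _%_ (x * 2) (2 ^ n * 2) {{nz}}
    ≡⟨ m%n*o≡m*o%[n*o] x (2 ^ n) 2 {{m^n≢0 2 n}} {{nz}} ⟨
  (x mod2^ n) * 2
    ≡⟨ *-comm (x mod2^ n) 2 ⟩
  2 * (x mod2^ n) ∎
  where
  open ≡-Reasoning
  nz : NonZero (2 ^ n * 2)
  nz = subst NonZero (*-comm 2 (2 ^ n)) (m^n≢0 2 (suc n))

%-≡⇒∣ : ∀ x z N .{{_ : NonZero N}} → (x + z) % N ≡ x % N → N ∣ z
%-≡⇒∣ x z N same = ∣m+n∣m⇒∣n (subst (N ∣_) (sym shifted) (n∣m*n (q₂))) (n∣m*n q₁)
  where
  q₁ = x / N
  q₂ = (x + z) / N
  shifted : q₁ * N + z ≡ q₂ * N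
  shifted = +-cancelˡ-≡ (x % N) _ _ (begin
    x % N + (q₁ * N + z)   ≡⟨ +-assoc (x % N) (q₁ * N) z ⟨
    x % N + q₁ * N + z     ≡⟨ cong (_+ z) (m≡m%n+[m/n]*n x N) ⟨
    x + z                  ≡⟨ m≡m%n+[m/n]*n (x + z) N ⟩
    (x + z) % N + q₂ * N   ≡⟨ cong (_+ q₂ * N) same ⟩
    x % N + q₂ * N ∎)
    where open ≡-Reasoning

2^∣odd*⇒2^∣ : ∀ n i z → 2 ^ n ∣ z * suc (2 * i) → 2 ^ n ∣ z
2^∣odd*⇒2^∣ zero    i z _ = 1∣ z
2^∣odd*⇒2^∣ (suc n) i z 2^n+1∣za
  with euclidsLemma z (suc (2 * i)) prime[2] (m*n∣⇒m∣ 2 (2 ^ n) 2^n+1∣za)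
... | inj₂ 2∣odd = ⊥-elim (2∤odd i 2∣odd)
... | inj₁ (divides w refl) = subst (_∣ w * 2) (*-comm (2 ^ n) 2)
        (*-monoˡ-∣ 2 (2^∣odd*⇒2^∣ n i w (*-cancelˡ-∣ 2 (subst (2 * 2 ^ n ∣_) regroup 2^n+1∣za))))
  where
  a = suc (2 * i)
  regroup : w * 2 * a ≡ 2 * (w * a)
  regroup = solve 2 (λ w a → w :* con 2 :* a := con 2 :* (w :* a)) refl w a

-- Multiplication by an odd number is injective on ℤ_{2^n}: if x ≤ y then
-- 2^n divides (y - x)·a, hence y - x, which is below 2^n.
odd-*-injective-≤ : ∀ n i {x y} → y < 2 ^ n → x ≤ y →
  (x * suc (2 * i)) mod2^ n ≡ (y * suc (2 * i)) mod2^ n → x ≡ y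
odd-*-injective-≤ n i {x} {y} y< x≤y same = begin
  x          ≡⟨ +-identityʳ x ⟨
  x + 0      ≡⟨ cong (x +_) gap≡0 ⟨
  x + gap    ≡⟨ m+[n∸m]≡n x≤y ⟩
  y ∎
  where
  open ≡-Reasoning
  instance _ = m^n≢0 2 n
  a = suc (2 * i)
  gap = y ∸ x
  ya : y * a ≡ x * a + gap * a
  ya = trans (cong (_* a) (sym (m+[n∸m]≡n x≤y))) (*-distribʳ-+ a x gap)
  2^n∣gap : 2 ^ n ∣ gap
  2^n∣gap = 2^∣odd*⇒2^∣ n i gap
    (%-≡⇒∣ (x * a) (gap * a) (2 ^ n) (trans (cong (_% 2 ^ n) (sym ya)) (sym same)))
  gap≡0 : gap ≡ 0
  gap≡0 with gap ≟ 0
  ... | yes gap≡0 = gap≡0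
  ... | no  gap≢0 = ⊥-elim (<-irrefl refl
          (≤-<-trans (∣⇒≤ {{≢-nonZero gap≢0}} 2^n∣gap) (≤-<-trans (m∸n≤m y x) y<)))

odd-*-injective : ∀ n i {x y} → x < 2 ^ n → y < 2 ^ n →
  (x * suc (2 * i)) mod2^ n ≡ (y * suc (2 * i)) mod2^ n → x ≡ y
odd-*-injective n i {x} {y} x< y< same with ≤-total x y
... | inj₁ x≤y = odd-*-injective-≤ n i y< x≤y same
... | inj₂ y≤x = sym (odd-*-injective-≤ n i x< y≤x (sym same))

2^∣-step : ∀ e x → 2 ^ e ∣ x → inLayerᵇ (suc e) x ≡ false → 2 ^ suc e ∣ x
2^∣-step e x (divides q refl) notInLayer with even-or-odd q
... | inj₁ q≡even = divides (q / 2) (begin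
  q * 2 ^ e               ≡⟨ cong (_* 2 ^ e) q≡even ⟩
  2 * (q / 2) * 2 ^ e     ≡⟨ solve 2 (λ h p → con 2 :* h :* p := h :* (con 2 :* p)) refl (q / 2) (2 ^ e) ⟩
  q / 2 * (2 * 2 ^ e) ∎)
  where open ≡-Reasoning
... | inj₂ q≡odd = ⊥-elim (subst T notInLayer (≡⇒≡ᵇ _ _ residue))
  where
  open ≡-Reasoning
  instance _ = m^n≢0 2 (suc e)
  residue : (q * 2 ^ e) mod2^ suc e ≡ 2 ^ e
  residue = begin
    (q * 2 ^ e) % 2 ^ suc e
      ≡⟨ cong (λ u → (u * 2 ^ e) % 2 ^ suc e) q≡odd ⟩
    (suc (2 * (q / 2)) * 2 ^ e) % 2 ^ suc e
      ≡⟨ cong (_% 2 ^ suc e)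
           (solve 2 (λ h p → (con 1 :+ con 2 :* h) :* p := p :+ h :* (con 2 :* p)) refl (q / 2) (2 ^ e)) ⟩
    (2 ^ e + q / 2 * 2 ^ suc e) % 2 ^ suc e
      ≡⟨ [m+kn]%n≡m%n (2 ^ e) (q / 2) (2 ^ suc e) ⟩
    2 ^ e % 2 ^ suc e
      ≡⟨ m<n⇒m%n≡m (subst (2 ^ e <_) (*-comm (2 ^ e) 2) (m<m*n (2 ^ e) 2 {{m^n≢0 2 e}} (s≤s (s≤s z≤n)))) ⟩
    2 ^ e ∎

outsideLayers-∣ : ∀ e x → inLayersUpToᵇ e x ≡ false → 2 ^ e ∣ x
outsideLayers-∣ zero    x _ = 1∣ x
outsideLayers-∣ (suc e) x notIn with inLayersUpToᵇ e x in notBelow | inLayerᵇ (suc e) x in notHere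
outsideLayers-∣ (suc e) x refl | false | false =
  2^∣-step e x (outsideLayers-∣ e x notBelow) notHere

-- x ↦ x / 2^e embeds the complement of L_1 ∪ ... ∪ L_e into [0, 2^(n-e)).
count-outsideLayers : ∀ e n → e ≤ n →
  count (λ x → not (inLayersUpToᵇ e x)) (2 ^ n) ≤ 2 ^ (n ∸ e)
count-outsideLayers e n e≤n =
  subst (count outside (2 ^ n) ≤_) (count-true (2 ^ (n ∸ e)))
    (count-injection (_/ 2 ^ e) (2 ^ n) (2 ^ (n ∸ e)) maps inj)
  where
  instance _ = m^n≢0 2 e
  outside = λ x → not (inLayersUpToᵇ e x)
  2^e∣ : ∀ x → outside x ≡ true → 2 ^ e ∣ x
  2^e∣ x out = outsideLayers-∣ e x (not-injective out)
  maps : ∀ x → x < 2 ^ n → outside x ≡ true → x / 2 ^ e < 2 ^ (n ∸ e) × true ≡ true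
  maps x x< _ = m<n*o⇒m/o<n
    (subst (x <_) (trans (sym (2^e*2^[n∸e] e n e≤n)) (*-comm (2 ^ e) (2 ^ (n ∸ e)))) x<) , refl
  inj : ∀ x y → x < 2 ^ n → y < 2 ^ n → outside x ≡ true → outside y ≡ true →
    x / 2 ^ e ≡ y / 2 ^ e → x ≡ y
  inj x y _ _ out-x out-y = /-cancelʳ-≡ (2^e∣ x out-x) (2^e∣ y out-y)

inF : List ℕ → ℕ → Bool
inF F x = does (x ∈? F)

missing : List ℕ → ℕ → Bool
missing F x = not (inF F x)

missing-false⇒∈ : ∀ F x → missing F x ≡ false → x ∈ F
missing-false⇒∈ F x notMissing with x ∈? F
... | yes x∈F = x∈F
... | no  _   with () ← notMissing

delete-head : ∀ x xs → ¬ x ∈ xs → ∀ y → delete (inF (x ∷ xs)) x y ≡ inF xs y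
delete-head x xs x∉xs y with y ≟ x
... | yes refl = trans (delete-self (inF (y ∷ xs)) y) (sym (dec-false (y ∈? xs) x∉xs))
... | no  y≢x  = trans (delete-≢ (inF (x ∷ xs)) y≢x)
                       (cong (_∨ inF xs y) (dec-false (y ≟ x) y≢x))

length≤count-inF : ∀ N (F : List ℕ) → Unique F → All (_< N) F → length F ≤ count (inF F) N
length≤count-inF N []       _            _          = z≤n
length≤count-inF N (x ∷ xs) (x∉ ∷ uniq) (x< ∷ xs<) = begin
  suc (length xs)                        ≤⟨ s≤s (length≤count-inF N xs uniq xs<) ⟩
  suc (count (inF xs) N)                 ≡⟨ cong suc (count-cong N (λ y _ → sym (delete-head x xs x∉xs y))) ⟩
  suc (count (delete (inF (x ∷ xs)) x) N) ≡⟨ count-delete (inF (x ∷ xs)) N x< (dec-true (x ∈? x ∷ xs) (here refl)) ⟨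
  count (inF (x ∷ xs)) N ∎
  where
  open ≤-Reasoning
  x∉xs : ¬ x ∈ xs
  x∉xs = All¬⇒¬Any x∉

length-filter-upTo : ∀ (p : ℕ → Bool) N → length (filter (λ x → T? (p x)) (upTo N)) ≡ count p N
length-filter-upTo p zero    = refl
length-filter-upTo p (suc N) = begin
  length (filter p? (upTo (suc N)))
    ≡⟨ cong (λ l → length (filter p? l)) (List.applyUpTo-∷ʳ (λ x → x) N) ⟨
  length (filter p? (upTo N ++ N ∷ []))
    ≡⟨ cong length (List.filter-++ p? (upTo N) (N ∷ [])) ⟩
  length (filter p? (upTo N) ++ filter p? (N ∷ []))
    ≡⟨ List.length-++ (filter p? (upTo N)) ⟩
  length (filter p? (upTo N)) + length (filter p? (N ∷ []))
    ≡⟨ cong₂ _+_ (length-filter-upTo p N) (singleton (p N) refl) ⟩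
  count p N + ind (p N) ∎
  where
  open ≡-Reasoning
  p? = λ x → T? (p x)
  singleton : ∀ b → p N ≡ b → length (filter p? (N ∷ [])) ≡ ind (p N)
  singleton true  pN rewrite pN = refl
  singleton false pN rewrite pN = refl

-- Cubes from arithmetic progressions.  With S = (b, a, ..., a) of length L,
-- the nonempty subsums of S are c·a (1 ≤ c < L) and b + c·a (c < L).

subsetSum-replicate : ∀ L a (I : Subset L) → subsetSum (replicate L a) I ≡ ∣ I ∣ * a
subsetSum-replicate zero    a []          = refl
subsetSum-replicate (suc L) a (true ∷ I)  = cong (a +_) (subsetSum-replicate L a I)
subsetSum-replicate (suc L) a (false ∷ I) = subsetSum-replicate L a I

nonempty⇒∣I∣≥1 : ∀ {L} (I : Subset L) → Nonempty I → 1 ≤ ∣ I ∣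
nonempty⇒∣I∣≥1 (true ∷ I)  _                = s≤s z≤n
nonempty⇒∣I∣≥1 (false ∷ I) (suc x , there x∈I) = nonempty⇒∣I∣≥1 I (x , x∈I)

all-replicate : ∀ {P : ℕ → Set} L a → P a → Vec.All P (replicate L a)
all-replicate zero    a pa = Vec.[]
all-replicate (suc L) a pa = pa Vec.∷ all-replicate L a pa

progression-cube : ∀ n L F a b → a < 2 ^ n → b < 2 ^ n →
  (∀ c → 1 ≤ c → c < L → (c * a) mod2^ n ∈ F) →
  (∀ c → c < L → (b + c * a) mod2^ n ∈ F) →
  ContainsProjCube n L F
progression-cube n zero    F a b a< b< multiples shifted = [] , Vec.[] , λ { [] (() , _) }
progression-cube n (suc L) F a b a< b< multiples shifted =
  b ∷ replicate L a , b< Vec.∷ all-replicate L a a< , subsums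
  where
  subsums : ProjCubeIn n (b ∷ replicate L a) F
  subsums (true ∷ I) _ =
    subst (λ s → (b + s) mod2^ n ∈ F) (sym (subsetSum-replicate L a I))
      (shifted ∣ I ∣ (s≤s (∣p∣≤n I)))
  subsums (false ∷ I) nonempty =
    subst (λ s → s mod2^ n ∈ F) (sym (subsetSum-replicate L a I))
      (multiples ∣ I ∣ (nonempty⇒∣I∣≥1 (false ∷ I) nonempty) (s≤s (∣p∣≤n I)))

block-meets-missing : ∀ n L F a m → a < 2 ^ n →
  (∀ c → 1 ≤ c → c < L → (c * a) mod2^ n ∈ F) → ¬ ContainsProjCube n L F →
  anyBelow L (λ c → missing F (((m * L + c) * a) mod2^ n)) ≡ true
block-meets-missing n L F a m a< multiples noCube with anyBelow L (λ c → missing F (((m * L + c) * a) mod2^ n)) in hits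
... | true  = refl
... | false = ⊥-elim (noCube (progression-cube n L F a b a< (mod2^< _ n) multiples shifted))
  where
  b = ((m * L) * a) mod2^ n
  shifted : ∀ c → c < L → (b + c * a) mod2^ n ∈ F
  shifted c c<L = subst (_∈ F) (sym b+ca≡) (missing-false⇒∈ F _ (anyBelow-false L _ hits c c<L))
    where
    b+ca≡ : (b + c * a) mod2^ n ≡ ((m * L + c) * a) mod2^ n
    b+ca≡ = trans (mod2^-+ˡ n (m * L * a) (c * a)) (cong (_mod2^ n) (sym (*-distribʳ-+ a (m * L) c)))

block-index : ∀ L .{{_ : NonZero L}} m c → c < L → (m * L + c) / L ≡ m
block-index L m c c<L = begin
  (m * L + c) / L       ≡⟨ +-distrib-/-∣ˡ c (n∣m*n m) ⟩
  m * L / L + c / L     ≡⟨ cong₂ _+_ (m*n/n≡m m L) (m<n⇒m/n≡0 c<L) ⟩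
  m + 0                 ≡⟨ +-identityʳ m ⟩
  m ∎
  where open ≡-Reasoning

block< : ∀ M L m c → m < M → c < L → m * L + c < M * L
block< M L m c m<M c<L = begin-strict
  m * L + c    <⟨ +-monoʳ-< (m * L) c<L ⟩
  m * L + L    ≡⟨ +-comm (m * L) L ⟩
  suc m * L    ≤⟨ *-monoˡ-≤ L m<M ⟩
  M * L ∎
  where open ≤-Reasoning

-- Picking one missing element in each of the 2^(n-e) blocks injectively
-- (odd a is a unit) shows |G| ≥ 2^(n-e).
goodMultiplier-bound : ∀ n e F i → e ≤ n → suc (2 * i) < 2 ^ n →
  (∀ c → 1 ≤ c → c < 2 ^ e → (c * suc (2 * i)) mod2^ n ∈ F) →
  ¬ ContainsProjCube n (2 ^ e) F → 2 ^ (n ∸ e) ≤ count (missing F) (2 ^ n)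
goodMultiplier-bound n e F i e≤n a< multiples noCube =
  subst (_≤ count (missing F) (2 ^ n)) (count-true M) (count-injection f M (2 ^ n) maps inj)
  where
  instance _ = m^n≢0 2 e
  L = 2 ^ e
  M = 2 ^ (n ∸ e)
  a = suc (2 * i)
  inBlock : ℕ → ℕ → Bool
  inBlock m c = missing F (((m * L + c) * a) mod2^ n)
  chosen : ℕ → ℕ
  chosen m = witness L (inBlock m)
  chosen-spec : ∀ m → chosen m < L × inBlock m (chosen m) ≡ true
  chosen-spec m = witness-spec L (inBlock m) (block-meets-missing n L F a m a< multiples noCube)
  f : ℕ → ℕ
  f m = ((m * L + chosen m) * a) mod2^ n
  block<2^n : ∀ m → m < M → m * L + chosen m < 2 ^ n
  block<2^n m m<M = subst (m * L + chosen m <_) (trans (*-comm M L) (2^e*2^[n∸e] e n e≤n))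
    (block< M L m (chosen m) m<M (proj₁ (chosen-spec m)))
  maps : ∀ m → m < M → true ≡ true → f m < 2 ^ n × missing F (f m) ≡ true
  maps m _ _ = mod2^< _ n , proj₂ (chosen-spec m)
  inj : ∀ m m′ → m < M → m′ < M → true ≡ true → true ≡ true → f m ≡ f m′ → m ≡ m′
  inj m m′ m<M m′<M _ _ fm≡fm′ = begin
    m                          ≡⟨ block-index L m (chosen m) (proj₁ (chosen-spec m)) ⟨
    (m * L + chosen m) / L     ≡⟨ cong (_/ L) (odd-*-injective n i (block<2^n m m<M) (block<2^n m′ m′<M) fm≡fm′) ⟩
    (m′ * L + chosen m′) / L   ≡⟨ block-index L m′ (chosen m′) (proj₁ (chosen-spec m′)) ⟩
    m′ ∎
    where open ≡-Reasoning

-- Case (B).  `hits g n e a` says that some multiple c·a mod 2^n with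
-- 1 ≤ c < 2^e satisfies g.  It is defined by splitting c into its odd values
-- 2j + 1 and its even values 2c′, using (2c′·a) mod 2^(n+1) = 2·(c′·a mod 2^n),
-- which is the recursion along which the double counting proceeds.
hits : (ℕ → Bool) → ℕ → ℕ → ℕ → Bool
hits g n       zero    a = false
hits g zero    (suc e) a = false
hits g (suc n) (suc e) a =
  anyBelow (2 ^ e) (λ j → g ((suc (2 * j) * a) mod2^ suc n)) ∨ hits (λ y → g (2 * y)) n e (a mod2^ n)

hits-complete : ∀ e n g a c → e ≤ n → hits g n e a ≡ false →
  1 ≤ c → c < 2 ^ e → g ((c * a) mod2^ n) ≡ false
hits-complete zero    n       g a c _         _    1≤c c<1 = ⊥-elim (<-irrefl refl (≤-trans 1≤c (≤-pred c<1)))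
hits-complete (suc e) (suc n) g a c (s≤s e≤n) none 1≤c c<
  with anyBelow (2 ^ e) (λ j → g ((suc (2 * j) * a) mod2^ suc n)) in noOdd
     | hits (λ y → g (2 * y)) n e (a mod2^ n) in noEven
hits-complete (suc e) (suc n) g a c (s≤s e≤n) refl 1≤c c< | false | false with even-or-odd c
... | inj₂ c≡odd = subst (λ u → g ((u * a) mod2^ suc n) ≡ false) (sym c≡odd)
                     (anyBelow-false (2 ^ e) _ noOdd (c / 2) (half<2^ e c c<))
... | inj₁ c≡even = subst (λ u → g ((u * a) mod2^ suc n) ≡ false) (sym c≡even)
                      (subst (λ u → g u ≡ false) doubled halfMiss)
  where
  h = c / 2
  h≥1 : 1 ≤ h
  h≥1 = n≢0⇒n>0 λ h≡0 → <⇒≢ 1≤c (sym (trans c≡even (cong (2 *_) h≡0)))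
  halfMiss : g (2 * ((h * (a mod2^ n)) mod2^ n)) ≡ false
  halfMiss = hits-complete e n (λ y → g (2 * y)) (a mod2^ n) h e≤n noEven h≥1 (half<2^ e c c<)
  doubled : 2 * ((h * (a mod2^ n)) mod2^ n) ≡ ((2 * h) * a) mod2^ suc n
  doubled = begin
    2 * ((h * (a mod2^ n)) mod2^ n)   ≡⟨ cong (2 *_) (mod2^-*ʳ n h a) ⟩
    2 * ((h * a) mod2^ n)             ≡⟨ mod2^-double n (h * a) ⟨
    (2 * (h * a)) mod2^ suc n         ≡⟨ cong (_mod2^ suc n) (*-assoc 2 h a) ⟨
    ((2 * h) * a) mod2^ suc n ∎
    where open ≡-Reasoning

-- Multiplication by an odd number maps the odd residues mod 2^(n+1)
-- injectively into themselves, so it cannot increase the number of odd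
-- residues satisfying g.
count-odd-multiples : ∀ n j (g : ℕ → Bool) →
  count (λ i → g ((suc (2 * j) * suc (2 * i)) mod2^ suc n)) (2 ^ n) ≤ count (λ i → g (suc (2 * i))) (2 ^ n)
count-odd-multiples n j g =
  count-injection {P = λ i → g (x i)} {Q = λ i → g (suc (2 * i))} (λ i → x i / 2) (2 ^ n) (2 ^ n) maps inj
  where
  x : ℕ → ℕ
  x i = (suc (2 * j) * suc (2 * i)) mod2^ suc n
  x-odd : ∀ i → x i ≡ suc (2 * (x i / 2))
  x-odd i = odd⇒≡suc[2*half] (x i) λ 2∣x →
    2∤odd*odd j i (∣n∣m%n⇒∣m {{m^n≢0 2 (suc n)}} (divides (2 ^ n) (*-comm 2 (2 ^ n))) 2∣x)
  maps : ∀ i → i < 2 ^ n → g (x i) ≡ true → x i / 2 < 2 ^ n × g (suc (2 * (x i / 2))) ≡ true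
  maps i _ gx = half<2^ n (x i) (mod2^< _ (suc n)) , subst (λ u → g u ≡ true) (x-odd i) gx
  inj : ∀ i i′ → i < 2 ^ n → i′ < 2 ^ n → g (x i) ≡ true → g (x i′) ≡ true → x i / 2 ≡ x i′ / 2 → i ≡ i′
  inj i i′ i< i′< _ _ same = *-cancelˡ-≡ i i′ 2 (suc-injective
    (odd-*-injective (suc n) j (odd<2^ n i i<) (odd<2^ n i′ i′<) (begin
      (suc (2 * i) * suc (2 * j)) mod2^ suc n    ≡⟨ cong (_mod2^ suc n) (*-comm (suc (2 * i)) _) ⟩
      x i                                        ≡⟨ x-odd i ⟩
      suc (2 * (x i / 2))                        ≡⟨ cong (λ h → suc (2 * h)) same ⟩
      suc (2 * (x i′ / 2))                       ≡⟨ x-odd i′ ⟨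
      x i′                                       ≡⟨ cong (_mod2^ suc n) (*-comm _ (suc (2 * i′))) ⟩
      (suc (2 * i′) * suc (2 * j)) mod2^ suc n ∎)))
    where open ≡-Reasoning

count-odd-mod : ∀ n p →
  count (λ i → p ((suc (2 * i)) mod2^ suc n)) (2 ^ suc n) ≡ 2 * count (λ i → p (suc (2 * i))) (2 ^ n)
count-odd-mod n p = begin
  count P (2 ^ n + (2 ^ n + 0))
    ≡⟨ count-+ P (2 ^ n) (2 ^ n + 0) ⟩
  count P (2 ^ n) + count (λ i → P (2 ^ n + i)) (2 ^ n + 0)
    ≡⟨ cong (count P (2 ^ n) +_) (cong (count (λ i → P (2 ^ n + i))) (+-identityʳ (2 ^ n))) ⟩
  count P (2 ^ n) + count (λ i → P (2 ^ n + i)) (2 ^ n)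
    ≡⟨ cong₂ _+_ (count-cong (2 ^ n) (λ i i< → cong p (low i i<)))
                 (count-cong (2 ^ n) (λ i i< → cong p (high i i<))) ⟩
  X + X
    ≡⟨ cong (X +_) (+-identityʳ X) ⟨
  2 * X ∎
  where
  open ≡-Reasoning
  instance _ = m^n≢0 2 (suc n)
  P = λ i → p ((suc (2 * i)) mod2^ suc n)
  X = count (λ i → p (suc (2 * i))) (2 ^ n)
  low : ∀ i → i < 2 ^ n → (suc (2 * i)) mod2^ suc n ≡ suc (2 * i)
  low i i< = m<n⇒m%n≡m (odd<2^ n i i<)
  high : ∀ i → i < 2 ^ n → (suc (2 * (2 ^ n + i))) mod2^ suc n ≡ suc (2 * i)
  high i i< = begin
    suc (2 * (2 ^ n + i)) % 2 ^ suc n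
      ≡⟨ cong (_% 2 ^ suc n) (solve 2 (λ q i → con 1 :+ con 2 :* (q :+ i) := con 1 :+ con 2 :* i :+ con 2 :* q) refl (2 ^ n) i) ⟩
    (suc (2 * i) + 2 ^ suc n) % 2 ^ suc n
      ≡⟨ [m+n]%n≡m%n (suc (2 * i)) (2 ^ suc n) ⟩
    suc (2 * i) % 2 ^ suc n
      ≡⟨ low i i< ⟩
    suc (2 * i) ∎

hits-count : ∀ e n g → e ≤ n →
  2 * count (λ i → hits g (suc n) e (suc (2 * i))) (2 ^ n) ≤ 2 ^ e * count g (2 ^ suc n)
hits-count zero    n       g _ = ≤-trans (≤-reflexive (cong (2 *_) (count-false (2 ^ n)))) z≤n
hits-count (suc e) (suc m) g (s≤s e≤m) = begin
  2 * count (λ i → oddHit i ∨ evenHit i) (2 ^ suc m)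
    ≤⟨ *-monoʳ-≤ 2 (count-∨ oddHit evenHit (2 ^ suc m)) ⟩
  2 * (count oddHit (2 ^ suc m) + count evenHit (2 ^ suc m))
    ≤⟨ *-monoʳ-≤ 2 (+-mono-≤ oddBound evenBound) ⟩
  2 * (2 ^ e * O + 2 ^ e * E)
    ≡⟨ solve 3 (λ p o e → con 2 :* (p :* o :+ p :* e) := (con 2 :* p) :* (e :+ o)) refl (2 ^ e) O E ⟩
  2 ^ suc e * (E + O)
    ≡⟨ cong (2 ^ suc e *_) (count-even-odd g (2 ^ suc m)) ⟨
  2 ^ suc e * count g (2 ^ suc (suc m)) ∎
  where
  open ≤-Reasoning
  g′ = λ y → g (2 * y)
  oddHit  = λ i → anyBelow (2 ^ e) (λ j → g ((suc (2 * j) * suc (2 * i)) mod2^ suc (suc m)))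
  evenHit = λ i → hits g′ (suc m) e ((suc (2 * i)) mod2^ suc m)
  O = count (λ i → g (suc (2 * i))) (2 ^ suc m)
  E = count g′ (2 ^ suc m)
  oddBound : count oddHit (2 ^ suc m) ≤ 2 ^ e * O
  oddBound = count-anyBelow (2 ^ e) (2 ^ suc m) O
    (λ j i → g ((suc (2 * j) * suc (2 * i)) mod2^ suc (suc m))) (λ j _ → count-odd-multiples (suc m) j g)
  evenBound : count evenHit (2 ^ suc m) ≤ 2 ^ e * E
  evenBound = subst (_≤ 2 ^ e * E) (sym (count-odd-mod m (hits g′ (suc m) e))) (hits-count e m g′ e≤m)

allHit-bound : ∀ e n g → e ≤ n → (∀ i → i < 2 ^ n → hits g (suc n) e (suc (2 * i)) ≡ true) →
  2 ^ (suc n ∸ e) ≤ count g (2 ^ suc n)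
allHit-bound e n g e≤n allHit = *-cancelˡ-≤ (2 ^ e) {{m^n≢0 2 e}} (begin
  2 ^ e * 2 ^ (suc n ∸ e)
    ≡⟨ 2^e*2^[n∸e] e (suc n) (m≤n⇒m≤1+n e≤n) ⟩
  2 * 2 ^ n
    ≡⟨ cong (2 *_) (trans (count-cong {q = λ _ → true} (2 ^ n) allHit) (count-true (2 ^ n))) ⟨
  2 * count (λ i → hits g (suc n) e (suc (2 * i))) (2 ^ n)
    ≤⟨ hits-count e n g e≤n ⟩
  2 ^ e * count g (2 ^ suc n) ∎)
  where open ≤-Reasoning

goodMultiplier : List ℕ → ℕ → ℕ → ℕ → Bool
goodMultiplier F n e i = not (hits (missing F) (suc n) e (suc (2 * i)))

missing-large : ∀ e n F → e ≤ n → ¬ ContainsProjCube (suc n) (2 ^ e) F →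
  2 ^ (suc n ∸ e) ≤ count (missing F) (2 ^ suc n)
missing-large e n F e≤n noCube with anyBelow (2 ^ n) (goodMultiplier F n e) in someGood
... | true = goodMultiplier-bound (suc n) e F i (m≤n⇒m≤1+n e≤n) (odd<2^ n i i<) multiples noCube
  where
  i = witness (2 ^ n) (goodMultiplier F n e)
  i-good = witness-spec (2 ^ n) (goodMultiplier F n e) someGood
  i< = proj₁ i-good
  multiples : ∀ c → 1 ≤ c → c < 2 ^ e → (c * suc (2 * i)) mod2^ suc n ∈ F
  multiples c 1≤c c< = missing-false⇒∈ F _ (hits-complete e (suc n) (missing F) (suc (2 * i)) c
    (m≤n⇒m≤1+n e≤n) (not-injective (proj₂ i-good)) 1≤c c<)
... | false = allHit-bound e n (missing F) e≤n λ i i< →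
  not-injective (anyBelow-false (2 ^ n) (goodMultiplier F n e) someGood i i<)

theorem1p6 : (n k : ℕ) → 2 ≤ k → k ≤ n →
    (F : List ℕ) → Unique F → All (λ x → x < 2 ^ n) F →
    ¬ ContainsProjCube n (2 ^ (k ∸ 1)) F →
    length F ≤ length (layersUpTo n (k ∸ 1))
theorem1p6 (suc n) (suc (suc e′)) (s≤s (s≤s _)) (s≤s e≤n) F uniq F< noCube = begin
  length F                      ≤⟨ length≤count-inF N F uniq F< ⟩
  count (inF F) N               ≤⟨ +-cancelʳ-≤ M (count (inF F) N) (count inLayers N) complements ⟩
  count inLayers N              ≡⟨ length-filter-upTo inLayers N ⟨
  length (layersUpTo (suc n) e) ∎
  where
  open ≤-Reasoning
  e = suc e′
  N = 2 ^ suc n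
  M = 2 ^ (suc n ∸ e)
  inLayers = inLayersUpToᵇ e
  complements : count (inF F) N + M ≤ count inLayers N + M
  complements = begin
    count (inF F) N + M
      ≤⟨ +-monoʳ-≤ (count (inF F) N) (missing-large e n F e≤n noCube) ⟩
    count (inF F) N + count (missing F) N
      ≡⟨ count-complement (inF F) N ⟩
    N
      ≡⟨ count-complement inLayers N ⟨
    count inLayers N + count (λ x → not (inLayers x)) N
      ≤⟨ +-monoʳ-≤ (count inLayers N) (count-outsideLayers e (suc n) (m≤n⇒m≤1+n e≤n)) ⟩
    count inLayers N + M ∎
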